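{- Let $n$ be a positive integer and let $S\subseteq\{1,\dots,n\}^2$. Then the set of boundary vertices of $T(S)$ in $R_n$ equals the set of boundary vertices of $T(S)$ in $S_n$, i.e. $\partial_{R_n}T(S)=\partial_{S_n}T(S)$.
   Context: $S_n$ is the $n\times n$ square grid graph with vertex set $\{1,\dots,n\}^2$ (first coordinate = column, increasing to the right; second = row, increasing upward), where $(x,y)$ and $(x',y')$ are adjacent iff $(x'-x,y'-y)\in\{(\pm1,0),(0,\pm1)\}$. $R_n$ has the same vertex set, with all edges of $S_n$ plus the diagonal edges joining $(x,y+1)$ and $(x+1,y)$ for $1\le x,y\le n-1$ (each unit square subdivided by its top-left to bottom-right diagonal; this is the triangulated rhombus). For a graph $H$ on this vertex set and $A\subseteq\{1,\dots,n\}^2$, $\partial_H A=\{v\in A: v \text{ is adjacent in } H \text{ to some } u\notin A\}$. Fall-down transformation: for $S\subseteq\{1,\dots,n\}^2$, let $c_x=|\{y:(x,y)\in S\}|$ and $S'=\{(x,y): 1\le y\le c_x\}$ (push each column down); then let $r_y=|\{x:(x,y)\in S'\}|$ and $T(S)=\{(x,y): 1\le x\le r_y\}$ (push each row to the left). -}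

module Defs where

open import Data.Nat using (ℕ; zero; suc; _+_; _≤_; _≤ᵇ_)
open import Data.Bool using (Bool; true; false; if_then_else_; _∧_)
open import Data.Product using (_×_; _,_; ∃-syntax)
open import Data.Sum using (_⊎_)
open import Relation.Binary.PropositionalEquality using (_≡_; _≢_)

-- Vertices are pairs (x , y) of naturals; x = column, y = row.
Vertex : Set
Vertex = ℕ × ℕ

InGrid : ℕ → Vertex → Set
InGrid n (x , y) = (1 ≤ x × x ≤ n) × (1 ≤ y × y ≤ n)

-- A subset of {1,…,n}² is given by its (decidable) indicator; only
-- values on {1,…,n}² are ever consulted.
GridSubset : Set
GridSubset = ℕ → ℕ → Bool

countUpTo : ℕ → (ℕ → Bool) → ℕ
countUpTo zero    f = 0
countUpTo (suc k) f = (if f (suc k) then 1 else 0) + countUpTo k f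

inRange : ℕ → ℕ → Bool
inRange n i = (1 ≤ᵇ i) ∧ (i ≤ᵇ n)

colCount : ℕ → GridSubset → ℕ → ℕ
colCount n S x = countUpTo n (λ y → S x y)

fallCols : ℕ → GridSubset → GridSubset
fallCols n S x y = inRange n x ∧ inRange n y ∧ (y ≤ᵇ colCount n S x)

rowCount : ℕ → GridSubset → ℕ → ℕ
rowCount n S y = countUpTo n (λ x → fallCols n S x y)

-- T(S) = {(x,y) : 1 ≤ x ≤ r_y}  (inside the grid)
fallDown : ℕ → GridSubset → GridSubset
fallDown n S x y = inRange n x ∧ inRange n y ∧ (x ≤ᵇ rowCount n S y)

-- Adjacency in S_n (on vertices; grid membership imposed separately)
SAdj : Vertex → Vertex → Set
SAdj (x , y) (x' , y') =
  (x' ≡ suc x × y' ≡ y) ⊎ (x ≡ suc x' × y ≡ y') ⊎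
  (x' ≡ x × y' ≡ suc y) ⊎ (x' ≡ x × y ≡ suc y')

RAdj : Vertex → Vertex → Set
RAdj (x , y) (x' , y') =
  SAdj (x , y) (x' , y') ⊎
  ((x' ≡ suc x × y ≡ suc y') ⊎ (x ≡ suc x' × y' ≡ suc y))

InBoundary : ℕ → (Vertex → Vertex → Set) → GridSubset → Vertex → Set
InBoundary n Adj A (x , y) =
  InGrid n (x , y) × A x y ≡ true ×
  ∃[ u ] (InGrid n u × Adj (x , y) u × A (Data.Product.proj₁ u) (Data.Product.proj₂ u) ≢ true)

-- T(S) is a staircase: it is closed under stepping one unit down or one unit
-- left inside the grid, since the row lengths r_y count a set S' that is
-- itself closed under stepping down, so they are non-increasing in y.  For
-- such a set A, if v ∈ A has a diagonal neighbour u ∉ A, then the remaining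
-- corner w of the unit square spanned by u and v is an axis neighbour of v,
-- and w ∉ A because u is one step down or left of w.  So the diagonals
-- create no new boundary vertices.
module Submission where

open import Defs
open import Data.Nat using (ℕ; zero; suc; _≤_; _≤ᵇ_; z≤n)
open import Data.Nat.Properties using (≤ᵇ⇒≤; ≤⇒≤ᵇ; ≤-refl; ≤-trans; <⇒≤; +-mono-≤)
open import Data.Bool using (Bool; true; false; _∧_; if_then_else_)
open import Data.Bool.Properties using (T-≡; ∧-conicalˡ; ∧-conicalʳ)
open import Data.Product using (_×_; _,_)
open import Data.Sum using (inj₁; inj₂)
open import Function using (_∘_)
open import Function.Bundles using (_⇔_; mk⇔; Equivalence)
open import Relation.Binary.PropositionalEquality using (_≡_; refl)

open Equivalence using (to; from)

∧≡true⇔ : ∀ {a b} → a ∧ b ≡ true ⇔ (a ≡ true × b ≡ true)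
∧≡true⇔ {a} {b} =
  mk⇔ (λ p → ∧-conicalˡ a b p , ∧-conicalʳ a b p) (λ { (refl , refl) → refl })

≤ᵇ≡true⇔≤ : ∀ {m k} → (m ≤ᵇ k) ≡ true ⇔ m ≤ k
≤ᵇ≡true⇔≤ {m} {k} = mk⇔ (≤ᵇ⇒≤ m k ∘ from T-≡) (to T-≡ ∘ ≤⇒≤ᵇ)

inRange≡true⇔ : ∀ {n i} → inRange n i ≡ true ⇔ (1 ≤ i × i ≤ n)
inRange≡true⇔ = mk⇔
  (λ p → let (p₁ , p₂) = to ∧≡true⇔ p in to ≤ᵇ≡true⇔≤ p₁ , to ≤ᵇ≡true⇔≤ p₂)
  (λ (p₁ , p₂) → from ∧≡true⇔ (from ≤ᵇ≡true⇔≤ p₁ , from ≤ᵇ≡true⇔≤ p₂))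

inGrid∧≤ᵇ≡true⇔ : ∀ {n x y a b} →
  (inRange n x ∧ inRange n y ∧ (a ≤ᵇ b)) ≡ true ⇔ (InGrid n (x , y) × a ≤ b)
inGrid∧≤ᵇ≡true⇔ = mk⇔
  (λ p → let (px , q) = to ∧≡true⇔ p ; (py , pab) = to ∧≡true⇔ q
         in (to inRange≡true⇔ px , to inRange≡true⇔ py) , to ≤ᵇ≡true⇔≤ pab)
  (λ ((gx , gy) , a≤b) →
     from ∧≡true⇔ (from inRange≡true⇔ gx ,
                   from ∧≡true⇔ (from inRange≡true⇔ gy , from ≤ᵇ≡true⇔≤ a≤b)))

indicator-mono : ∀ {a b : Bool} → (a ≡ true → b ≡ true) →
  (if a then 1 else 0) ≤ (if b then 1 else 0)
indicator-mono {false}         _   = z≤n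
indicator-mono {true}  {true}  _   = ≤-refl
indicator-mono {true}  {false} a⇒b with () ← a⇒b refl

countUpTo-mono : ∀ k {f g : ℕ → Bool} → (∀ i → f i ≡ true → g i ≡ true) →
  countUpTo k f ≤ countUpTo k g
countUpTo-mono zero    f⇒g = z≤n
countUpTo-mono (suc k) f⇒g =
  +-mono-≤ (indicator-mono (f⇒g (suc k))) (countUpTo-mono k f⇒g)

fallCols≡true⇔ : ∀ n S x y →
  fallCols n S x y ≡ true ⇔ (InGrid n (x , y) × y ≤ colCount n S x)
fallCols≡true⇔ n S x y = inGrid∧≤ᵇ≡true⇔ {n} {x} {y}

fallDown≡true⇔ : ∀ n S x y →
  fallDown n S x y ≡ true ⇔ (InGrid n (x , y) × x ≤ rowCount n S y)
fallDown≡true⇔ n S x y = inGrid∧≤ᵇ≡true⇔ {n} {x} {y}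

DownClosed : GridSubset → Set
DownClosed A = ∀ x y → 1 ≤ y → A x (suc y) ≡ true → A x y ≡ true

LeftClosed : GridSubset → Set
LeftClosed A = ∀ x y → 1 ≤ x → A (suc x) y ≡ true → A x y ≡ true

fallCols-downClosed : ∀ n S → DownClosed (fallCols n S)
fallCols-downClosed n S x y 1≤y p =
  let ((gx , (_ , sy≤n)) , sy≤c) = to (fallCols≡true⇔ n S x (suc y)) p
  in from (fallCols≡true⇔ n S x y) ((gx , (1≤y , <⇒≤ sy≤n)) , <⇒≤ sy≤c)

rowCount-antitone : ∀ n S y → 1 ≤ y → rowCount n S (suc y) ≤ rowCount n S y
rowCount-antitone n S y 1≤y = countUpTo-mono n (λ x → fallCols-downClosed n S x y 1≤y)

fallDown-downClosed : ∀ n S → DownClosed (fallDown n S)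
fallDown-downClosed n S x y 1≤y p =
  let ((gx , (_ , sy≤n)) , x≤r) = to (fallDown≡true⇔ n S x (suc y)) p
  in from (fallDown≡true⇔ n S x y)
       ((gx , (1≤y , <⇒≤ sy≤n)) , ≤-trans x≤r (rowCount-antitone n S y 1≤y))

fallDown-leftClosed : ∀ n S → LeftClosed (fallDown n S)
fallDown-leftClosed n S x y 1≤x p =
  let (((_ , sx≤n) , gy) , sx≤r) = to (fallDown≡true⇔ n S (suc x) y) p
  in from (fallDown≡true⇔ n S x y) (((1≤x , <⇒≤ sx≤n) , gy) , <⇒≤ sx≤r)

boundaryS⇒boundaryR : ∀ {n A v} → InBoundary n SAdj A v → InBoundary n RAdj A v
boundaryS⇒boundaryR (gv , v∈A , u , gu , v~u , u∉A) = gv , v∈A , u , gu , inj₁ v~u , u∉A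

boundaryR⇒boundaryS : ∀ {n A} → DownClosed A → LeftClosed A →
  ∀ {v} → InBoundary n RAdj A v → InBoundary n SAdj A v
boundaryR⇒boundaryS _ _ (gv , v∈A , u , gu , inj₁ v~u , u∉A) =
  gv , v∈A , u , gu , v~u , u∉A
boundaryR⇒boundaryS down _ {x , suc y}
  ((gx , gsy) , v∈A , (suc x , y) , (gsx , (1≤y , _)) , inj₂ (inj₁ (refl , refl)) , u∉A) =
  (gx , gsy) , v∈A , (suc x , suc y) , (gsx , gsy) , inj₁ (refl , refl) ,
  u∉A ∘ down (suc x) y 1≤y
boundaryR⇒boundaryS _ left {suc x , y}
  ((gsx , gy) , v∈A , (x , suc y) , ((1≤x , _) , gsy) , inj₂ (inj₂ (refl , refl)) , u∉A) =
  (gsx , gy) , v∈A , (suc x , suc y) , (gsx , gsy) , inj₂ (inj₂ (inj₁ (refl , refl))) ,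
  u∉A ∘ left x (suc y) 1≤x

mainTheorem8 : (n : ℕ) → 1 ≤ n → (S : GridSubset) → (v : Vertex) →
    InBoundary n RAdj (fallDown n S) v ⇔ InBoundary n SAdj (fallDown n S) v
mainTheorem8 n _ S v =
  mk⇔ (boundaryR⇒boundaryS (fallDown-downClosed n S) (fallDown-leftClosed n S))
      boundaryS⇒boundaryR
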